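{- Let a conjunctive Boolean control network (CBCN) be given in which no state-variable that is not directly controlled has a constant update function. If the CBCN is controllable, then its dependency graph is acyclic.
   Context: A CBCN with $n$ Boolean state-variables and control index set $\mathcal{I}\subseteq\{1,\dots,n\}$ evolves by $X_i(k+1)=U_i(k)$ for $i\in\mathcal{I}$ and $X_i(k+1)=\prod_{j=1}^n (X_j(k))^{\epsilon_{ji}}$ for $i\notin\mathcal{I}$, where $\epsilon_{ji}\in\{0,1\}$, products denote AND, $x^0=1$, and the $U_i(k)$ are independent Boolean controls; a state-variable $i\notin\mathcal{I}$ has a constant update function if $\epsilon_{ji}=0$ for all $j$. It is controllable if for every $a,b\in\{0,1\}^n$ there exist $N\ge 0$ and controls steering $X(0)=a$ to $X(N)=b$. Its dependency graph is the digraph with a vertex for each state-variable (a simple node) and a vertex for each control input $U_i$, $i\in\mathcal{I}$ (a generator), with an arc $j\to i$ whenever $i\notin\mathcal{I}$ and $\epsilon_{ji}=1$, and an arc $U_i\to i$ for each $i\in\mathcal{I}$. -}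

module Defs where

open import Data.Nat using (ℕ)
open import Data.Fin using (Fin)
open import Data.Bool using (Bool; true; false; if_then_else_; _∧_; not; T)
open import Data.List using (List; []; _∷_; foldl)
open import Data.Sum using (_⊎_; inj₁; inj₂)
open import Data.Product using (Σ; ∃; _×_)
open import Data.Vec.Functional using (foldr)
open import Relation.Binary.PropositionalEquality using (_≡_)
open import Relation.Nullary using (¬_)

-- A conjunctive Boolean control network with n state-variables.
-- ctrl i = true  iff  i ∈ I (the control index set).
-- eps j i  is  ε_{ji}.
record CBCN (n : ℕ) : Set where
  field
    ctrl : Fin n → Bool
    eps  : Fin n → Fin n → Bool

State : ℕ → Set
State n = Fin n → Bool

-- A control value at one time step: U_i(k) for every i (only the values at
-- controlled indices i ∈ I are used).
Control : ℕ → Set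
Control n = Fin n → Bool

-- x^ε with x^0 = 1
pow : Bool → Bool → Bool
pow x true  = x
pow x false = true

module _ {n : ℕ} (C : CBCN n) where
  open CBCN C

  step : State n → Control n → State n
  step x u i = if ctrl i then u i else foldr _∧_ true (λ j → pow (x j) (eps j i))

  run : State n → List (Control n) → State n
  run x []       = x
  run x (u ∷ us) = run (step x u) us

  Controllable : Set
  Controllable = (a b : State n) → ∃ λ (us : List (Control n)) → run a us ≡ b

  ConstantUpdate : Fin n → Set
  ConstantUpdate i = ctrl i ≡ false × ((j : Fin n) → eps j i ≡ false)

  -- Dependency graph: simple nodes (state-variables) and generators U_i, i ∈ I.
  Vertex : Set
  Vertex = Fin n ⊎ Σ (Fin n) (λ i → ctrl i ≡ true)

  data Arc : Vertex → Vertex → Set where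
    state-arc : ∀ {j i} → ctrl i ≡ false → eps j i ≡ true → Arc (inj₁ j) (inj₁ i)
    gen-arc   : ∀ {i} (p : ctrl i ≡ true) → Arc (inj₂ (Data.Product._,_ i p)) (inj₁ i)

  data Walk⁺ : Vertex → Vertex → Set where
    [_]  : ∀ {u v} → Arc u v → Walk⁺ u v
    _∷ʷ_ : ∀ {u v w} → Arc u v → Walk⁺ v w → Walk⁺ u w

  Acyclic : Set
  Acyclic = (v : Vertex) → ¬ Walk⁺ v v

module Submission where

-- A controllable network must be able to steer the all-false
-- state to the all-true state.  Generators have no incoming arcs, so every
-- directed cycle of the dependency graph runs through simple nodes only, and
-- each of its arcs j → i is a state-arc: i is uncontrolled and X_j occurs as a
-- factor of the conjunction updating X_i.  Hence if all variables on a cycle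
-- are 0 at time k, then all of them are 0 at time k+1 (each has a predecessor
-- on the cycle that is 0).  Starting from the all-false state this invariant
-- holds forever, so the all-true state is never reached — a contradiction.

open import Defs
open import Data.Nat using (ℕ; suc)
open import Data.Fin using (Fin; zero; suc)
open import Data.Bool using (Bool; true; false; _∧_)
open import Data.List using (List; []; _∷_)
open import Data.Sum using (inj₁; inj₂)
open import Data.Product using (_×_; _,_)
import Data.Vec.Functional as Vec
open import Relation.Binary.PropositionalEquality using (_≡_; refl; sym; trans; cong)
open import Relation.Nullary using (¬_)

conjunction-false : ∀ {m} (f : Fin m → Bool) (k : Fin m) → f k ≡ false →
  Vec.foldr _∧_ true f ≡ false
conjunction-false {suc m} f zero    fk≡false rewrite fk≡false = refl
conjunction-false {suc m} f (suc k) fk≡false with f zero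
... | true  = conjunction-false (λ j → f (suc j)) k fk≡false
... | false = refl

module _ {n : ℕ} (C : CBCN n) where
  open CBCN C

  target : ∀ {u v} → Arc C u v → Fin n
  target (state-arc {i = i} _ _) = i
  target (gen-arc {i = i} _)     = i

  no-walk-into-generator : ∀ {u g} → ¬ Walk⁺ C u (inj₂ g)
  no-walk-into-generator [ () ]
  no-walk-into-generator (_ ∷ʷ w) = no-walk-into-generator w

  -- An arc leaving a simple node j is a state-arc j → i, so X_j is a factor
  -- of the update of X_i: if X_j is 0 now, X_i is 0 after any step.
  arc-propagates-zero : ∀ {j v} (a : Arc C (inj₁ j) v) (x : State n) (u : Control n) →
    x j ≡ false → step C x u (target a) ≡ false
  arc-propagates-zero (state-arc {j = j} {i = i} uncontrolled ε≡true) x u xj≡false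
    rewrite uncontrolled =
      conjunction-false (λ k → pow (x k) (eps k i)) j factor-false
    where
    factor-false : pow (x j) (eps j i) ≡ false
    factor-false rewrite ε≡true = xj≡false

  Off : ∀ {u v} → Walk⁺ C u v → State n → Set
  Off [ a ]    x = x (target a) ≡ false
  Off (a ∷ʷ w) x = x (target a) ≡ false × Off w x

  off-at-end : ∀ {u t} (w : Walk⁺ C u (inj₁ t)) (x : State n) → Off w x → x t ≡ false
  off-at-end [ state-arc _ _ ] x off       = off
  off-at-end [ gen-arc _ ]     x off       = off
  off-at-end (_ ∷ʷ w)          x (_ , off) = off-at-end w x off

  off-all-false : ∀ {u v} (w : Walk⁺ C u v) → Off w (λ _ → false)
  off-all-false [ _ ]    = refl
  off-all-false (_ ∷ʷ w) = refl , off-all-false w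

  -- One step preserves the invariant of a walk whose start vertex is 0,
  -- since each arc's source is then 0 as well.
  off-step : ∀ {s v} (w : Walk⁺ C (inj₁ s) v) (x : State n) (u : Control n) →
    x s ≡ false → Off w x → Off w (step C x u)
  off-step [ a ] x u xs≡false _ = arc-propagates-zero a x u xs≡false
  off-step (a@(state-arc _ _) ∷ʷ w) x u xs≡false (xi≡false , off) =
    arc-propagates-zero a x u xs≡false , off-step w x u xi≡false off

  -- On a closed walk the start is also the end, so the invariant is preserved
  -- by every step and hence along every run.
  off-run : ∀ {s} (w : Walk⁺ C (inj₁ s) (inj₁ s)) (us : List (Control n)) (x : State n) →
    Off w x → Off w (run C x us)
  off-run w []       x off = off
  off-run w (u ∷ us) x off =
    off-run w us (step C x u) (off-step w x u (off-at-end w x off) off)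

  cycle-stays-off : ∀ {s} (w : Walk⁺ C (inj₁ s) (inj₁ s)) (us : List (Control n)) →
    run C (λ _ → false) us s ≡ false
  cycle-stays-off w us = off-at-end w _ (off-run w us _ (off-all-false w))

proposition1 : (n : ℕ) (C : CBCN n) →
    ((i : Fin n) → ¬ ConstantUpdate C i) →
    Controllable C → Acyclic C
proposition1 n C _ controllable (inj₂ g) cycle = no-walk-into-generator C cycle
proposition1 n C _ controllable (inj₁ s) cycle
  with controllable (λ _ → false) (λ _ → true)
... | us , reaches-all-true
  with trans (sym (cong (λ x → x s) reaches-all-true)) (cycle-stays-off C cycle us)
...   | ()
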